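{- Let $G$ be a long-refinement graph with at least two vertices. Then there exist $d_1,d_2 \in \mathbb{N}_0$ with $d_1 \neq d_2$ such that $\deg(G) = \{d_1,d_2\}$.
   Context: All graphs are finite, simple, undirected, with monochromatic initial colouring. Colour Refinement computes $\chi^0_G$ constant and $\chi^i_G(v) = \big(\chi^{i-1}_G(v), \{\!\{\chi^{i-1}_G(w) \mid w \in N(v)\}\!\}\big)$; $\pi^i_G$ is the partition of $V(G)$ into colour classes of $\chi^i_G$, and $\mathrm{WL}_1(G)$ is the least $j \geq 0$ with $\pi^j_G = \pi^{j+1}_G$. A long-refinement graph is a graph $G$ with $\mathrm{WL}_1(G) = |G|-1$. $\deg(G)$ denotes the set $\{\deg(v) \mid v \in V(G)\}$ of vertex degrees occurring in $G$. -}

module Defs where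

open import Data.Nat using (ℕ; zero; suc; _+_; _∸_; _<_; _≡ᵇ_)
open import Data.Nat.ListAction using (sum)
open import Data.Bool.ListAction using (and)
open import Data.Product using (_×_)
open import Data.Bool using (Bool; true; false; _∧_; if_then_else_)
open import Data.Fin using (Fin)
open import Data.List using (List; allFin; map)
open import Relation.Binary.PropositionalEquality using (_≡_)
open import Relation.Nullary using (¬_)

record Graph : Set where
  field
    order : ℕ
    adj   : Fin order → Fin order → Bool
    adj-sym   : ∀ v w → adj v w ≡ adj w v
    adj-irrefl : ∀ v → adj v v ≡ false

open Graph public

countV : (G : Graph) → (Fin (order G) → Bool) → ℕ
countV G P = sum (map (λ x → if P x then 1 else 0) (allFin (order G)))

deg : (G : Graph) → Fin (order G) → ℕ
deg G v = countV G (adj G v)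

-- Colour Refinement, represented by the equivalence relation
-- "χ^i_G(v) = χ^i_G(w)" (i.e. by the partition π^i_G).
-- χ^0 is constant; χ^{i+1}(v) = χ^{i+1}(w) iff χ^i(v) = χ^i(w) and the
-- multisets {{χ^i(x) | x ∈ N(v)}} and {{χ^i(x) | x ∈ N(w)}} coincide, i.e.
-- for every colour c = χ^i(u) the number of neighbours of colour c agrees.
sameColour : (G : Graph) → ℕ → Fin (order G) → Fin (order G) → Bool
sameColour G zero    v w = true
sameColour G (suc i) v w =
  sameColour G i v w ∧
  and (map (λ u → countV G (λ x → adj G v x ∧ sameColour G i x u)
                 ≡ᵇ countV G (λ x → adj G w x ∧ sameColour G i x u))
           (allFin (order G)))

Stable : (G : Graph) → ℕ → Set
Stable G j = ∀ v w → sameColour G j v w ≡ sameColour G (suc j) v w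

IsWL1 : Graph → ℕ → Set
IsWL1 G j = Stable G j × (∀ k → k < j → ¬ Stable G k)

LongRefinement : Graph → Set
LongRefinement G = IsWL1 G (order G ∸ 1)

-- Measure each round of Colour Refinement by the number of colour
-- classes, witnessed by k vertices of pairwise different colours. Two
-- general facts about equivalence relations drive the argument:
--   * on Fin n no relation has more than n classes (pigeonhole);
--   * if F refines a decidable equivalence E and has no more classes
--     than E, then F = E (a pair split by F would create a new class).
-- Hence every round r < WL₁(G) = n - 1 has strictly fewer colours than
-- round r + 1. Counting down from at most n colours in round n - 1 leaves
-- at most 2 colours in round 1, and round-1 colours are exactly degrees;
-- so there are at most two degrees. Round 0 is not stable either, so
-- round 1 is non-constant: some two vertices have different degrees.
module Submission where

open import Defs
open import Data.Nat using (ℕ; _≤_)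
open import Data.Fin using (Fin)
open import Data.Product using (Σ; ∃; _×_; _,_)
open import Data.Sum using (_⊎_)
open import Relation.Binary.PropositionalEquality using (_≡_; _≢_)

open import Data.Nat using (zero; suc; _+_; _∸_; _<_; z≤n; s≤s; _≡ᵇ_)
open import Data.Nat.Properties
  using (_≟_; ≡ᵇ⇒≡; ≡⇒≡ᵇ; <⇒≤; ≤-trans; ≤-reflexive; ∸-monoˡ-<; m∸n+n≡m; +-suc)
open import Data.Fin using (zero; suc; fromℕ<)
open import Data.Fin.Properties using (any?; pigeonhole; <⇒≢) renaming (_≟_ to _≟ᶠ_)
open import Data.Vec.Functional using ([]; _∷_)
open import Data.Bool using (Bool; true; false; T; _∧_; if_then_else_)
open import Data.Bool.Properties using (T-∧; ∧-identityʳ)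
open import Data.Bool.ListAction using (and)
open import Data.Nat.ListAction using (sum)
open import Data.List using (map; allFin)
open import Data.List.Properties using (map-cong)
open import Data.List.Relation.Unary.All using (lookup)
open import Data.List.Relation.Unary.All.Properties using (all⁺; all⁻; tabulate⁺)
open import Data.List.Membership.Propositional.Properties using (∈-allFin)
open import Data.Product using (proj₁; proj₂)
open import Data.Sum using (inj₁; inj₂)
open import Data.Unit using (tt)
open import Data.Empty using (⊥-elim)
open import Function using (_∘_; _⇔_; mk⇔; Equivalence)
open import Level using (0ℓ)
open import Relation.Binary.Core using (Rel; _⇒_)
open import Relation.Binary.Definitions using (Reflexive; Symmetric)
open import Relation.Binary.Structures using (IsDecEquivalence)
open import Relation.Binary.PropositionalEquality using (refl; sym; trans; cong; subst)
open import Relation.Nullary using (¬_; yes; no; ¬?)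
open import Relation.Nullary.Decidable using (decidable-stable; T?)

open Equivalence using (to; from)

module _ {A : Set} where

  Spread : Rel A 0ℓ → (k : ℕ) → (Fin k → A) → Set
  Spread _≈_ k f = ∀ i j → i ≢ j → ¬ f i ≈ f j

  AtLeastClasses : Rel A 0ℓ → ℕ → Set
  AtLeastClasses _≈_ k = Σ (Fin k → A) (Spread _≈_ k)

  spread-extend : ∀ {_≈_ k f} → Symmetric _≈_ → Spread _≈_ k f →
                  (x : A) → (∀ j → ¬ x ≈ f j) → Spread _≈_ (suc k) (x ∷ f)
  spread-extend ≈-sym sp x fresh zero    zero    0≢0 = ⊥-elim (0≢0 refl)
  spread-extend ≈-sym sp x fresh zero    (suc j) _   = fresh j
  spread-extend ≈-sym sp x fresh (suc i) zero    _   = fresh i ∘ ≈-sym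
  spread-extend ≈-sym sp x fresh (suc i) (suc j) i≢j = sp i j (i≢j ∘ cong suc)

  spread-refine : ∀ {E F : Rel A 0ℓ} {k f} → F ⇒ E → Spread E k f → Spread F k f
  spread-refine F⇒E sp i j i≢j = sp i j i≢j ∘ F⇒E

classes-bounded : ∀ {n k} {_≈_ : Rel (Fin n) 0ℓ} → Reflexive _≈_ → n < k →
                  ¬ AtLeastClasses _≈_ k
classes-bounded {_≈_ = _≈_} ≈-refl n<k (f , sp) with pigeonhole n<k f
... | i , j , i<j , fi≡fj = sp i j (<⇒≢ i<j) (subst (f i ≈_) fi≡fj ≈-refl)

module Saturation {A : Set} {E F : Rel A 0ℓ}
  (E-isDecEquivalence : IsDecEquivalence E)
  (F-isDecEquivalence : IsDecEquivalence F)
  (F⇒E : F ⇒ E) where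

  private
    module E = IsDecEquivalence E-isDecEquivalence
    module F = IsDecEquivalence F-isDecEquivalence

  -- x shares the E-class of f i but not its F-class; since the other f j
  -- lie in other E-classes, x is F-apart from all of them.
  outside : ∀ {k f x} i → Spread E k f → E x (f i) → ¬ F x (f i) →
            ∀ j → ¬ F x (f j)
  outside i sp Exi ¬Fxi j with i ≟ᶠ j
  ... | yes refl = ¬Fxi
  ... | no i≢j   = λ Fxj → sp i j i≢j (E.trans (E.sym Exi) (F⇒E Fxj))

  -- A pair that E identifies but F splits produces an element F-apart
  -- from all listed representatives of E-classes: v if it is F-apart from
  -- the representative of its E-class, and w otherwise.
  split-adds-class : ∀ {k f v w} → Spread E k f → E v w → ¬ F v w →
                     Σ A λ x → ∀ j → ¬ F x (f j)
  split-adds-class {f = f} {v} {w} sp Evw ¬Fvw with any? (λ j → E._≟_ v (f j))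
  ... | no noClass = v , λ j Fvj → noClass (j , F⇒E Fvj)
  ... | yes (i , Evi) with F._≟_ v (f i)
  ...   | no ¬Fvi = v , outside i sp Evi ¬Fvi
  ...   | yes Fvi = w , outside i sp (E.trans (E.sym Evw) Evi)
                                     (λ Fwi → ¬Fvw (F.trans Fvi (F.sym Fwi)))

  saturated : ∀ {k f} → Spread E k f → ¬ AtLeastClasses F (suc k) → E ⇒ F
  saturated {f = f} sp noMore {v} {w} Evw with F._≟_ v w
  ... | yes Fvw = Fvw
  ... | no ¬Fvw with split-adds-class sp Evw ¬Fvw
  ...   | x , fresh = ⊥-elim (noMore (x ∷ f , moreClasses))
    where
    moreClasses : Spread F (suc _) (x ∷ f)
    moreClasses = spread-extend {_≈_ = F} F.sym (spread-refine {E = E} F⇒E sp) x fresh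

T-and-allFin : ∀ {n} (p : Fin n → Bool) →
               T (and (map p (allFin n))) ⇔ (∀ u → T (p u))
T-and-allFin {n} p = mk⇔ (λ t u → lookup (all⁺ p (allFin n) t) (∈-allFin u))
                         (λ h → all⁻ p (tabulate⁺ h))

T-ext : ∀ {a b} → (T a → T b) → (T b → T a) → a ≡ b
T-ext {false} {false} _   _   = refl
T-ext {false} {true}  _   b→a = ⊥-elim (b→a tt)
T-ext {true}  {false} a→b _   = ⊥-elim (a→b tt)
T-ext {true}  {true}  _   _   = refl

module _ (G : Graph) where

  Same : ℕ → Rel (Fin (order G)) 0ℓ
  Same i v w = T (sameColour G i v w)

  neighbours : ℕ → Fin (order G) → Fin (order G) → ℕ
  neighbours i v u = countV G (λ x → adj G v x ∧ sameColour G i x u)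

  same-suc : ∀ i v w → Same (suc i) v w ⇔
             (Same i v w × (∀ u → neighbours i v u ≡ neighbours i w u))
  same-suc i v w = mk⇔
    (λ s → let old , counts = to T-∧ s in
           old , λ u → ≡ᵇ⇒≡ _ _ (to (T-and-allFin countsAgree) counts u))
    (λ (old , counts) → from T-∧
           (old , from (T-and-allFin countsAgree) (λ u → ≡⇒≡ᵇ _ _ (counts u))))
    where
    countsAgree : Fin (order G) → Bool
    countsAgree u = neighbours i v u ≡ᵇ neighbours i w u

  same-isDecEquivalence : ∀ i → IsDecEquivalence (Same i)
  same-isDecEquivalence zero = record
    { isEquivalence = record { refl = tt ; sym = λ _ → tt ; trans = λ _ _ → tt }
    ; _≟_ = λ _ _ → yes tt }
  same-isDecEquivalence (suc i) = record
    { isEquivalence = record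
      { refl  = λ {v} → from (same-suc i v v) (S.refl , λ _ → refl)
      ; sym   = λ {v} {w} s → let o , c = to (same-suc i v w) s in
                from (same-suc i w v) (S.sym o , λ u → sym (c u))
      ; trans = λ {u} {v} {w} s t →
                let o , c = to (same-suc i u v) s ; o′ , c′ = to (same-suc i v w) t in
                from (same-suc i u w) (S.trans o o′ , λ x → trans (c x) (c′ x)) }
    ; _≟_ = λ v w → T? (sameColour G (suc i) v w) }
    where module S = IsDecEquivalence (same-isDecEquivalence i)

  -- Round 0 is monochromatic, so counting neighbours of a round-0 colour
  -- counts all neighbours.
  neighbours-zero : ∀ v u → neighbours 0 v u ≡ deg G v
  neighbours-zero v u = cong sum (map-cong indicator (allFin _))
    where
    indicator : ∀ x → (if adj G v x ∧ true then 1 else 0) ≡ (if adj G v x then 1 else 0)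
    indicator x = cong (λ b → if b then 1 else 0) (∧-identityʳ (adj G v x))

  same₁⇔deg : ∀ {v w} → Same 1 v w ⇔ (deg G v ≡ deg G w)
  same₁⇔deg {v} {w} = mk⇔
    (λ s → trans (sym (neighbours-zero v v))
             (trans (proj₂ (to (same-suc 0 v w) s) v) (neighbours-zero w v)))
    (λ e → from (same-suc 0 v w)
             (tt , λ u → trans (neighbours-zero v u) (trans e (sym (neighbours-zero w u)))))

  stable-if-unsplit : ∀ {i} → (Same i ⇒ Same (suc i)) → Stable G i
  stable-if-unsplit {i} unsplit v w = T-ext unsplit (proj₁ ∘ to (same-suc i v w))

  AtMostColours : ℕ → ℕ → Set
  AtMostColours i k = ¬ AtLeastClasses (Same i) (suc k)

  at-most-order : ∀ {i k} → order G ≤ k → AtMostColours i k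
  at-most-order {i} n≤k =
    classes-bounded {_≈_ = Same i} (IsDecEquivalence.refl (same-isDecEquivalence i)) (s≤s n≤k)

  unstable-fewer : ∀ {i k} → ¬ Stable G i →
                   AtMostColours (suc i) (suc k) → AtMostColours i k
  unstable-fewer {i} unstable bound (f , sp) =
    unstable (stable-if-unsplit {i} (Saturation.saturated
      (same-isDecEquivalence i) (same-isDecEquivalence (suc i)) refines sp bound))
    where
    refines : Same (suc i) ⇒ Same i
    refines {v} {w} = proj₁ ∘ to (same-suc i v w)

  unstable-descend : (∀ r → suc r < order G → ¬ Stable G r) →
                     ∀ j {i k} → j + i < order G →
                     AtMostColours (j + i) (j + k) → AtMostColours i k
  unstable-descend unstable zero    _  bound = bound
  unstable-descend unstable (suc j) {i} {k} lt bound =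
    unstable-descend unstable j (<⇒≤ lt)
      (unstable-fewer {j + i} {j + k} (unstable (j + i) lt) bound)

  long-unstable : LongRefinement G → ∀ r → suc r < order G → ¬ Stable G r
  long-unstable (_ , earlier) r sr<n = earlier r (∸-monoˡ-< sr<n (s≤s z≤n))

  atMostTwoColours : 2 ≤ order G → LongRefinement G → AtMostColours 1 2
  atMostTwoColours 2≤n long =
    unstable-descend (long-unstable long) (order G ∸ 2) {1} {2}
      (≤-reflexive (trans (sym (+-suc (order G ∸ 2) 1)) n∸2+2))
      (at-most-order {order G ∸ 2 + 1} (≤-reflexive (sym n∸2+2)))
    where
    n∸2+2 : order G ∸ 2 + 2 ≡ order G
    n∸2+2 = m∸n+n≡m 2≤n

  vertex₀ : 2 ≤ order G → Fin (order G)
  vertex₀ 2≤n = fromℕ< (≤-trans (s≤s z≤n) 2≤n)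

  twoDegreesOccur : 2 ≤ order G → ¬ Stable G 0 →
                    Σ (Fin (order G)) λ v₁ → Σ (Fin (order G)) λ v₂ → deg G v₁ ≢ deg G v₂
  -- Otherwise all degrees equal that of a fixed vertex v₀, so round 1 does
  -- not split round 0.
  twoDegreesOccur 2≤n unstable
    with any? (λ v → ¬? (deg G v ≟ deg G (vertex₀ 2≤n)))
  ... | yes (v , d≢) = vertex₀ 2≤n , v , d≢ ∘ sym
  ... | no none = ⊥-elim (unstable (stable-if-unsplit {0} λ {v} {w} _ →
                    from same₁⇔deg (trans (regular v) (sym (regular w)))))
    where
    regular : ∀ v → deg G v ≡ deg G (vertex₀ 2≤n)
    regular v = decidable-stable (deg G v ≟ _) (λ d≢ → none (v , d≢))

  noThirdDegree : AtMostColours 1 2 → ∀ {v₁ v₂} → deg G v₁ ≢ deg G v₂ →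
                  ∀ u → deg G u ≡ deg G v₁ ⊎ deg G u ≡ deg G v₂
  noThirdDegree atMostTwo {v₁} {v₂} d₁≢d₂ u with deg G u ≟ deg G v₁ | deg G u ≟ deg G v₂
  ... | yes d≡d₁ | _        = inj₁ d≡d₁
  ... | no _     | yes d≡d₂ = inj₂ d≡d₂
  ... | no d≢d₁  | no d≢d₂  = ⊥-elim (atMostTwo (_ , threeColours))
    where
    apart : ∀ {x y} → deg G x ≢ deg G y → ¬ Same 1 x y
    apart d≢ = d≢ ∘ to same₁⇔deg
    symm : Symmetric (Same 1)
    symm = IsDecEquivalence.sym (same-isDecEquivalence 1)
    threeColours : Spread (Same 1) 3 (u ∷ v₁ ∷ v₂ ∷ [])
    threeColours =
      spread-extend {_≈_ = Same 1} symm
        (spread-extend {_≈_ = Same 1} symm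
          (spread-extend {_≈_ = Same 1} symm (λ ()) v₂ (λ ()))
          v₁ (λ { zero → apart d₁≢d₂ ; (suc ()) }))
        u (λ { zero → apart d≢d₁ ; (suc zero) → apart d≢d₂ ; (suc (suc ())) })

corollary9 : (G : Graph) → 2 ≤ order G → LongRefinement G →
    Σ ℕ λ d₁ → Σ ℕ λ d₂ → d₁ ≢ d₂ ×
    (∀ v → deg G v ≡ d₁ ⊎ deg G v ≡ d₂) ×
    (∃ λ v → deg G v ≡ d₁) × (∃ λ v → deg G v ≡ d₂)
corollary9 G 2≤n long
  with twoDegreesOccur G 2≤n (long-unstable G long 0 2≤n)
... | v₁ , v₂ , d₁≢d₂ =
  deg G v₁ , deg G v₂ , d₁≢d₂ ,
  noThirdDegree G (atMostTwoColours G 2≤n long) d₁≢d₂ ,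
  (v₁ , refl) , (v₂ , refl)
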